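{- Let $q$ be an odd prime power and $\chi_1$ the coloring defined below on $V=(\mathbb{F}_q^*)^3$. Let $a,b,c,d\in V$ be four distinct vertices with $\chi_1(a,b)=\chi_1(a,c)=\chi_1(a,d)=(T,\alpha,i)$. If any of the following holds: (1) $T\in\{\mathrm{ZERO},\mathrm{UP}_2,\mathrm{DOWN}_2\}$; (2) $T=\mathrm{UP}_1$ and $a_1<\alpha-a_1$; (3) $T=\mathrm{DOWN}_1$ and $a_1>\alpha-a_1$, then the three edges $\{b,c\},\{b,d\},\{c,d\}$ receive three distinct colors under $\chi_1$.
   Context: $q$ is an odd prime power, $\mathbb{F}_q^*$ the nonzero elements of $\mathbb{F}_q$, and $V=(\mathbb{F}_q^*)^3$. For $x,y\in\mathbb{F}_q^3$, $x\cdot y=x_1y_1+x_2y_2+x_3y_3$. Fix an arbitrary linear order $<$ on $\mathbb{F}_q$ and extend it lexicographically to vectors: $x<y$ iff $x_i<y_i$ at the first position $i$ where $x_i\neq y_i$. For distinct $x,y\in V$ define $T(x,y)$ to be: $\mathrm{UP}_1$ if $x\cdot y=x\cdot x$ and $x_1<y_1$; $\mathrm{UP}_2$ if $x\cdot y=x\cdot x$, $x_1=y_1$ and $x<y$; $\mathrm{DOWN}_1$ if $x\cdot y\ne x\cdot x$, $x\cdot y=y\cdot y$ and $x_1<y_1$; $\mathrm{DOWN}_2$ if $x\cdot y\neq x\cdot x$, $x\cdot y=y\cdot y$, $x_1=y_1$ and $x<y$; $\mathrm{ZERO}$ if $x\cdot y\notin\{x\cdot x,y\cdot y\}$ and $x\cdot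 y=0$; $\mathrm{DOT}$ otherwise. Let $f_T(x,y)=x_1+y_1$ if $T\in\{\mathrm{UP}_1,\mathrm{DOWN}_1,\mathrm{ZERO}\}$, $f_T(x,y)=x_2+y_2$ if $T\in\{\mathrm{UP}_2,\mathrm{DOWN}_2\}$, and $f_T(x,y)=x\cdot y$ if $T=\mathrm{DOT}$. Let $\delta(x,y)=0$ if $\{x,y\}$ is linearly dependent and $1$ otherwise. For $x<y$ set $\chi_1(x,y)=(T,f_T(x,y),\delta(x,y))$ with $T=T(x,y)$; this is the color of the edge $\{x,y\}$, so $\chi_1(y,x)=\chi_1(x,y)$. -}

module Defs where

open import Level using (0ℓ)
open import Data.Nat using (ℕ)
open import Data.Fin using (Fin)
import Data.Fin.Properties as FinP
open import Data.Product using (Σ; ∃; _×_; _,_; proj₁; proj₂)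
open import Data.Sum using (_⊎_; inj₁; inj₂)
open import Data.Bool using (Bool; true; false)
open import Relation.Nullary using (¬_; Dec; yes; no)
open import Relation.Binary using (Rel; IsStrictTotalOrder; Tri; tri<; tri≈; tri>)
open import Relation.Binary.PropositionalEquality using (_≡_; refl; sym; trans; cong)
open import Algebra.Structures using (IsCommutativeRing)
open import Function.Bundles using (_↔_; Inverse)

-- A finite field of odd order.  Every finite field has prime-power
-- order q, and q is odd iff 1 + 1 ≠ 0; so "F_q with q an odd prime
-- power" is exactly a finite field with 1 + 1 ≠ 0.

record FiniteOddField : Set₁ where
  field
    Carrier : Set
    _+_ _*_ : Carrier → Carrier → Carrier
    -_      : Carrier → Carrier
    0# 1#   : Carrier
    isCommutativeRing : IsCommutativeRing _≡_ _+_ _*_ -_ 0# 1#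
    0≢1     : ¬ (0# ≡ 1#)
    inverse : ∀ x → ¬ (x ≡ 0#) → ∃ λ y → x * y ≡ 1#
    size    : ℕ
    finite  : Carrier ↔ Fin size
    odd     : ¬ ((1# + 1#) ≡ 0#)

  infixl 6 _+_
  infixl 7 _*_

  _-_ : Carrier → Carrier → Carrier
  x - y = x + (- y)

  _≟_ : (x y : Carrier) → Dec (x ≡ y)
  x ≟ y with FinP._≟_ (Inverse.to finite x) (Inverse.to finite y)
  ... | yes e = yes (trans (sym (fx x)) (trans (cong (Inverse.from finite) e) (fx y)))
    where fx : ∀ z → Inverse.from finite (Inverse.to finite z) ≡ z
          fx z = Inverse.inverseʳ finite refl
  ... | no ne = no λ e → ne (cong (Inverse.to finite) e)

  any? : (P : Carrier → Set) → (∀ x → Dec (P x)) → Dec (∃ P)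
  any? P P? with FinP.any? (λ k → P? (Inverse.from finite k))
  ... | yes (k , p) = yes (Inverse.from finite k , p)
  ... | no np = no λ { (x , p) → np (Inverse.to finite x , subst' (sym (Inverse.inverseʳ finite refl)) p) }
    where subst' : ∀ {a b} → a ≡ b → P a → P b
          subst' refl p = p

data EdgeType : Set where
  UP₁ UP₂ DOWN₁ DOWN₂ ZERO DOT : EdgeType

module Coloring (F : FiniteOddField) (_<_ : Rel (FiniteOddField.Carrier F) 0ℓ)
                (lin : IsStrictTotalOrder _≡_ _<_) where

  open FiniteOddField F

  Vec3 : Set
  Vec3 = Carrier × Carrier × Carrier

  c₁ c₂ c₃ : Vec3 → Carrier
  c₁ (x , _ , _) = x
  c₂ (_ , y , _) = y
  c₃ (_ , _ , z) = z

  InV : Vec3 → Set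
  InV x = ¬ (c₁ x ≡ 0#) × ¬ (c₂ x ≡ 0#) × ¬ (c₃ x ≡ 0#)

  V : Set
  V = Σ Vec3 InV

  _·_ : Vec3 → Vec3 → Carrier
  x · y = c₁ x * c₁ y + c₂ x * c₂ y + c₃ x * c₃ y

  _*ᵥ_ : Carrier → Vec3 → Vec3
  λ' *ᵥ x = (λ' * c₁ x , λ' * c₂ x , λ' * c₃ x)

  _<ₗ_ : Vec3 → Vec3 → Set
  x <ₗ y = (c₁ x < c₁ y)
         ⊎ (c₁ x ≡ c₁ y × ((c₂ x < c₂ y) ⊎ (c₂ x ≡ c₂ y × c₃ x < c₃ y)))

  _<?_ : (a b : Carrier) → Dec (a < b)
  a <? b with IsStrictTotalOrder.compare lin a b
  ... | tri< p _ _ = yes p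
  ... | tri≈ np _ _ = no np
  ... | tri> np _ _ = no np

  _<ₗ?_ : (x y : Vec3) → Dec (x <ₗ y)
  x <ₗ? y with c₁ x <? c₁ y
  ... | yes p = yes (inj₁ p)
  ... | no np with c₁ x ≟ c₁ y
  ...   | no ne = no λ { (inj₁ p) → np p ; (inj₂ (e , _)) → ne e }
  ...   | yes e with c₂ x <? c₂ y
  ...     | yes p = yes (inj₂ (e , inj₁ p))
  ...     | no np2 with c₂ x ≟ c₂ y
  ...       | no ne2 = no λ { (inj₁ p) → np p ; (inj₂ (_ , inj₁ p)) → np2 p ; (inj₂ (_ , inj₂ (e2 , _))) → ne2 e2 }
  ...       | yes e2 with c₃ x <? c₃ y
  ...         | yes p3 = yes (inj₂ (e , inj₂ (e2 , p3)))
  ...         | no np3 = no λ { (inj₁ p) → np p ; (inj₂ (_ , inj₁ p)) → np2 p ; (inj₂ (_ , inj₂ (_ , p3))) → np3 p3 }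

  edgeType : Vec3 → Vec3 → EdgeType
  edgeType x y with (x · y) ≟ (x · x)
  ... | yes _ with c₁ x <? c₁ y
  ...   | yes _ = UP₁
  ...   | no _ with c₁ x ≟ c₁ y | x <ₗ? y
  ...     | yes _ | yes _ = UP₂
  ...     | _     | _     = DOT
  edgeType x y | no _ with (x · y) ≟ (y · y)
  ...   | yes _ with c₁ x <? c₁ y
  ...     | yes _ = DOWN₁
  ...     | no _ with c₁ x ≟ c₁ y | x <ₗ? y
  ...       | yes _ | yes _ = DOWN₂
  ...       | _     | _     = DOT
  edgeType x y | no _ | no _ with (x · y) ≟ 0#
  ...     | yes _ = ZERO
  ...     | no _  = DOT

  fT : EdgeType → Vec3 → Vec3 → Carrier
  fT UP₁   x y = c₁ x + c₁ y
  fT DOWN₁ x y = c₁ x + c₁ y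
  fT ZERO  x y = c₁ x + c₁ y
  fT UP₂   x y = c₂ x + c₂ y
  fT DOWN₂ x y = c₂ x + c₂ y
  fT DOT   x y = x · y

  -- {x,y} linearly dependent.  For nonzero x (as in V) this is
  -- equivalent to: y is a scalar multiple of x.
  LinDep : Vec3 → Vec3 → Set
  LinDep x y = ∃ λ a → ∃ λ b → ((¬ (a ≡ 0#)) ⊎ (¬ (b ≡ 0#)))
                         × ((a *ᵥ x) ≡ (b *ᵥ y) )

  -- δ(x,y) = 0 if dependent, 1 otherwise (encoded as false / true)
  δ : Vec3 → Vec3 → Bool
  δ x y with any? (λ a → ∃ λ b → ((¬ (a ≡ 0#)) ⊎ (¬ (b ≡ 0#))) × ((a *ᵥ x) ≡ (b *ᵥ y)))
                  (λ a → any? _ (λ b → dec a b))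
    where
      decNZ : ∀ a → Dec (¬ (a ≡ 0#))
      decNZ a with a ≟ 0#
      ... | yes e = no λ ne → ne e
      ... | no ne = yes ne
      decEq3 : (u v : Vec3) → Dec (u ≡ v)
      decEq3 (u1 , u2 , u3) (v1 , v2 , v3) with u1 ≟ v1 | u2 ≟ v2 | u3 ≟ v3
      ... | yes refl | yes refl | yes refl = yes refl
      ... | no n | _ | _ = no λ { refl → n refl }
      ... | yes _ | no n | _ = no λ { refl → n refl }
      ... | yes _ | yes _ | no n = no λ { refl → n refl }
      dec : ∀ a b → Dec (((¬ (a ≡ 0#)) ⊎ (¬ (b ≡ 0#))) × ((a *ᵥ x) ≡ (b *ᵥ y)))
      dec a b with decNZ a | decNZ b | decEq3 (a *ᵥ x) (b *ᵥ y)
      ... | _ | _ | no n = no λ p → n (proj₂ p)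
      ... | yes p | _ | yes e = yes (inj₁ p , e)
      ... | no _ | yes p | yes e = yes (inj₂ p , e)
      ... | no n1 | no n2 | yes e = no λ { (inj₁ p , _) → n1 p ; (inj₂ p , _) → n2 p }
  ... | yes _ = false
  ... | no _  = true

  Color : Set
  Color = EdgeType × Carrier × Bool

  -- χ₁(x,y) for x <ₗ y
  χ₀ : Vec3 → Vec3 → Color
  χ₀ x y = (edgeType x y , fT (edgeType x y) x y , δ x y)

  χ₁ : V → V → Color
  χ₁ (x , _) (y , _) with x <ₗ? y
  ... | yes _ = χ₀ x y
  ... | no _  = χ₀ y x

-- All neighbours b of a with colour (T , α , i) lie on one line inside a plane x₁ = const:
-- the line x₁ = a₁, x₂ = α − a₂ if T is UP₂ or DOWN₂, and otherwise x₁ = α − a₁, a · x = K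
-- with K = 0 for ZERO and K = a · a for UP₁ and DOWN₁ (the order hypothesis fixes which end of
-- the edge is a). An edge between two points with equal first coordinate has type UP₂, DOWN₂,
-- ZERO or DOT, so two equally coloured edges uv, uw give either v₂ = w₂ and u · v ∈ {u · u, v · v},
-- or u · v = u · w ≠ u · u. On the line the first forces u = v or v = w; in the second,
-- u · (v − w) = 0 makes u · x constant along the line, whence u · v = u · u.
module Submission where

open import Defs
open import Level using (0ℓ)
open import Data.Product using (Σ; _×_; _,_; proj₁; proj₂)
open import Data.Product.Relation.Binary.Lex.Strict using (×-isStrictTotalOrder)
open import Data.Product.Relation.Binary.Pointwise.NonDependent using (Pointwise; ≡×≡⇒≡)
open import Data.Sum using (_⊎_; inj₁; inj₂)
open import Data.Bool using (Bool)
open import Data.Empty using (⊥; ⊥-elim)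
open import Relation.Nullary using (¬_; yes; no)
open import Relation.Binary using (Rel; IsStrictTotalOrder; tri<; tri≈; tri>)
open import Relation.Binary.PropositionalEquality
  using (_≡_; refl; sym; trans; cong; cong₂; subst; subst₂; ≢-sym; module ≡-Reasoning)
open import Algebra.Bundles using (CommutativeRing)

module Rainbow (F : FiniteOddField) (_<_ : Rel (FiniteOddField.Carrier F) 0ℓ)
               (lin : IsStrictTotalOrder _≡_ _<_) where

  open FiniteOddField F
  open Coloring F _<_ lin
  open IsStrictTotalOrder lin using (irrefl; asym)

  ring : CommutativeRing 0ℓ 0ℓ
  ring = record { isCommutativeRing = isCommutativeRing }

  open CommutativeRing ring
    using (+-assoc; +-comm; *-assoc; *-comm; *-identityˡ; +-group; commutativeSemiring)
  open import Algebra.Properties.Group +-group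
    using (∙-cancelˡ; ∙-cancelʳ; x∙y⁻¹≈ε⇒x≈y; //-rightDividesˡ; //-rightDividesʳ)
  open import Algebra.Solver.Ring.NaturalCoefficients.Default commutativeSemiring
    using (solve; _:+_; _:*_; _:=_)
  open ≡-Reasoning

  *-cancelˡ-nonZero : ∀ {x y z} → ¬ x ≡ 0# → x * y ≡ x * z → y ≡ z
  *-cancelˡ-nonZero {x} {y} {z} x≢0 xy≡xz with inverse x x≢0
  ... | x⁻¹ , xx⁻¹≡1 = begin
    y              ≡⟨ sym (*-identityˡ y) ⟩
    1# * y         ≡⟨ cong (_* y) x⁻¹x≡1 ⟨
    x⁻¹ * x * y    ≡⟨ *-assoc x⁻¹ x y ⟩
    x⁻¹ * (x * y)  ≡⟨ cong (x⁻¹ *_) xy≡xz ⟩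
    x⁻¹ * (x * z)  ≡⟨ *-assoc x⁻¹ x z ⟨
    x⁻¹ * x * z    ≡⟨ cong (_* z) x⁻¹x≡1 ⟩
    1# * z         ≡⟨ *-identityˡ z ⟩
    z              ∎
    where
    x⁻¹x≡1 : x⁻¹ * x ≡ 1#
    x⁻¹x≡1 = trans (*-comm x⁻¹ x) xx⁻¹≡1

  x≡y+z⇒y≡x-z : ∀ {x y z} → x ≡ y + z → y ≡ x - z
  x≡y+z⇒y≡x-z {y = y} {z} x≡y+z = trans (sym (//-rightDividesʳ z y)) (cong (_- z) (sym x≡y+z))

  x≡y+z⇒z≡x-y : ∀ {x y z} → x ≡ y + z → z ≡ x - y
  x≡y+z⇒z≡x-y {y = y} {z} x≡y+z = x≡y+z⇒y≡x-z (trans x≡y+z (+-comm y z))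

  cross-cancel : ∀ {s t m m′} → ¬ s ≡ t → s * m + t * m′ ≡ s * m′ + t * m → m ≡ m′
  cross-cancel {s} {t} {m} {m′} s≢t cross =
    *-cancelˡ-nonZero d≢0 (∙-cancelʳ (t * m + t * m′) (d * m) (d * m′) (begin
      d * m + (t * m + t * m′)   ≡⟨ expand m m′ ⟨
      (d + t) * m + t * m′       ≡⟨ cong (λ r → r * m + t * m′) d+t≡s ⟩
      s * m + t * m′             ≡⟨ cross ⟩
      s * m′ + t * m             ≡⟨ cong (λ r → r * m′ + t * m) d+t≡s ⟨
      (d + t) * m′ + t * m       ≡⟨ expand m′ m ⟩
      d * m′ + (t * m′ + t * m)  ≡⟨ cong (d * m′ +_) (+-comm (t * m′) (t * m)) ⟩
      d * m′ + (t * m + t * m′)  ∎))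
    where
    d = s - t
    d≢0 : ¬ d ≡ 0#
    d≢0 d≡0 = s≢t (x∙y⁻¹≈ε⇒x≈y s t d≡0)
    d+t≡s : d + t ≡ s
    d+t≡s = //-rightDividesˡ t s
    expand : ∀ x y → (d + t) * x + t * y ≡ d * x + (t * x + t * y)
    expand = solve 4 (λ d t x y → (d :+ t) :* x :+ t :* y := d :* x :+ (t :* x :+ t :* y)) refl d t

  -- Two affine functions of the same variable that agree at two distinct points have equal slopes.
  slopes-equal : ∀ {A B s t m m′} → ¬ s ≡ t →
                 A + s * m ≡ s * m′ + B → A + t * m ≡ t * m′ + B → m ≡ m′
  slopes-equal {A} {B} {s} {t} {m} {m′} s≢t at-s at-t = cross-cancel s≢t (∙-cancelˡ (A + B) _ _ (begin
    (A + B) + (s * m + t * m′)   ≡⟨ regroup A B (s * m) (t * m′) ⟩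
    (A + s * m) + (t * m′ + B)   ≡⟨ cong₂ _+_ at-s (sym at-t) ⟩
    (s * m′ + B) + (A + t * m)   ≡⟨ regroup′ A B (s * m′) (t * m) ⟩
    (A + B) + (s * m′ + t * m)   ∎))
    where
    regroup : ∀ a b x y → (a + b) + (x + y) ≡ (a + x) + (y + b)
    regroup = solve 4 (λ a b x y → (a :+ b) :+ (x :+ y) := (a :+ x) :+ (y :+ b)) refl
    regroup′ : ∀ a b x y → (x + b) + (a + y) ≡ (a + b) + (x + y)
    regroup′ = solve 4 (λ a b x y → (x :+ b) :+ (a :+ y) := (a :+ b) :+ (x :+ y)) refl

  Vec2 : Set
  Vec2 = Carrier × Carrier

  _·₂_ : Vec2 → Vec2 → Carrier
  (x₂ , x₃) ·₂ (y₂ , y₃) = x₂ * y₂ + x₃ * y₃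

  Parallel : Vec2 → Vec2 → Set
  Parallel (n₂ , n₃) (u₂ , u₃) = n₂ * u₃ ≡ n₃ * u₂

  -- n₃ (u·x) − u₃ (n·x) = x₂ (n₃ u₂ − n₂ u₃), with the negative terms moved across.
  ·₂-exchange : ∀ n₂ n₃ u₂ u₃ x₂ x₃ →
    n₃ * ((u₂ , u₃) ·₂ (x₂ , x₃)) + x₂ * (n₂ * u₃) ≡ x₂ * (n₃ * u₂) + u₃ * ((n₂ , n₃) ·₂ (x₂ , x₃))
  ·₂-exchange = solve 6 (λ n₂ n₃ u₂ u₃ x₂ x₃ →
    n₃ :* (u₂ :* x₂ :+ u₃ :* x₃) :+ x₂ :* (n₂ :* u₃)
      := x₂ :* (n₃ :* u₂) :+ u₃ :* (n₂ :* x₂ :+ n₃ :* x₃)) refl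

  parallel-from-two-points : ∀ n u v w → ¬ proj₁ v ≡ proj₁ w →
    n ·₂ v ≡ n ·₂ w → u ·₂ v ≡ u ·₂ w → Parallel n u
  parallel-from-two-points (n₂ , n₃) (u₂ , u₃) (v₂ , v₃) (w₂ , w₃) v₂≢w₂ nv≡nw uv≡uw =
    slopes-equal v₂≢w₂ (·₂-exchange n₂ n₃ u₂ u₃ v₂ v₃)
      (subst₂ (λ r s → n₃ * r + w₂ * (n₂ * u₃) ≡ w₂ * (n₃ * u₂) + u₃ * s)
              (sym uv≡uw) (sym nv≡nw) (·₂-exchange n₂ n₃ u₂ u₃ w₂ w₃))

  parallel-level-set : ∀ n u {x y} → Parallel n u → ¬ proj₂ n ≡ 0# →
    n ·₂ x ≡ n ·₂ y → u ·₂ x ≡ u ·₂ y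
  parallel-level-set n@(n₂ , n₃) u@(u₂ , u₃) {x} {y} n∥u n₃≢0 nx≡ny = *-cancelˡ-nonZero n₃≢0 (begin
    n₃ * (u ·₂ x)  ≡⟨ proportional x ⟩
    u₃ * (n ·₂ x)  ≡⟨ cong (u₃ *_) nx≡ny ⟩
    u₃ * (n ·₂ y)  ≡⟨ proportional y ⟨
    n₃ * (u ·₂ y)  ∎)
    where
    proportional : ∀ z → n₃ * (u ·₂ z) ≡ u₃ * (n ·₂ z)
    proportional (z₂ , z₃) = ∙-cancelʳ (z₂ * (n₂ * u₃)) _ _ (begin
      n₃ * (u ·₂ (z₂ , z₃)) + z₂ * (n₂ * u₃)  ≡⟨ ·₂-exchange n₂ n₃ u₂ u₃ z₂ z₃ ⟩
      z₂ * (n₃ * u₂) + u₃ * (n ·₂ (z₂ , z₃))  ≡⟨ +-comm _ _ ⟩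
      u₃ * (n ·₂ (z₂ , z₃)) + z₂ * (n₃ * u₂)  ≡⟨ cong (λ r → u₃ * (n ·₂ (z₂ , z₃)) + z₂ * r) n∥u ⟨
      u₃ * (n ·₂ (z₂ , z₃)) + z₂ * (n₂ * u₃)  ∎)

  ·-comm : ∀ x y → x · y ≡ y · x
  ·-comm x y = cong₂ _+_ (cong₂ _+_ (*-comm (c₁ x) (c₁ y)) (*-comm (c₂ x) (c₂ y))) (*-comm (c₃ x) (c₃ y))

  ·-cancel₃ : ∀ x {y z} → c₁ y ≡ c₁ z → c₂ y ≡ c₂ z → ¬ c₃ x ≡ 0# → x · y ≡ x · z → y ≡ z
  ·-cancel₃ x {_ , _ , _} {_ , _ , _} refl refl x₃≢0 xy≡xz =
    cong (λ t → _ , _ , t) (*-cancelˡ-nonZero x₃≢0 (∙-cancelˡ _ _ _ xy≡xz))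

  ·-split : ∀ x y → x · y ≡ c₁ x * c₁ y + proj₂ x ·₂ proj₂ y
  ·-split x y = +-assoc (c₁ x * c₁ y) (c₂ x * c₂ y) (c₃ x * c₃ y)

  ·-tail : ∀ x {y z} → c₁ y ≡ c₁ z → x · y ≡ x · z → proj₂ x ·₂ proj₂ y ≡ proj₂ x ·₂ proj₂ z
  ·-tail x {y} {z} y₁≡z₁ xy≡xz = ∙-cancelˡ (c₁ x * c₁ z) _ _ (begin
    c₁ x * c₁ z + proj₂ x ·₂ proj₂ y  ≡⟨ cong (λ r → c₁ x * r + proj₂ x ·₂ proj₂ y) y₁≡z₁ ⟨
    c₁ x * c₁ y + proj₂ x ·₂ proj₂ y  ≡⟨ ·-split x y ⟨
    x · y                             ≡⟨ xy≡xz ⟩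
    x · z                             ≡⟨ ·-split x z ⟩
    c₁ x * c₁ z + proj₂ x ·₂ proj₂ z  ∎)

  ·-untail : ∀ x {y z} → c₁ y ≡ c₁ z → proj₂ x ·₂ proj₂ y ≡ proj₂ x ·₂ proj₂ z → x · y ≡ x · z
  ·-untail x {y} {z} y₁≡z₁ e = begin
    x · y                             ≡⟨ ·-split x y ⟩
    c₁ x * c₁ y + proj₂ x ·₂ proj₂ y  ≡⟨ cong₂ (λ r s → c₁ x * r + s) y₁≡z₁ e ⟩
    c₁ x * c₁ z + proj₂ x ·₂ proj₂ z  ≡⟨ ·-split x z ⟨
    x · z                             ∎

  data Line : Set where
    vertical : (p q : Carrier) → Line
    oblique  : (p : Carrier) (n : Vec3) (K : Carrier) → ¬ c₃ n ≡ 0# → Line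

  _∈ℓ_ : Vec3 → Line → Set
  x ∈ℓ vertical p q     = c₁ x ≡ p × c₂ x ≡ q
  x ∈ℓ oblique p n K _  = c₁ x ≡ p × n · x ≡ K

  -- Equal values at two points force u ∥ n in the last two coordinates, so u · x is constant on the line.
  oblique-dot-constant : ∀ {p n K} (n₃≢0 : ¬ c₃ n ≡ 0#) {u v w} →
    let ℓ = oblique p n K n₃≢0 in u ∈ℓ ℓ → v ∈ℓ ℓ → w ∈ℓ ℓ →
    ¬ v ≡ w → u · v ≡ u · w → u · v ≡ u · u
  oblique-dot-constant {n = n} n₃≢0 {u} {v} {w} (u₁ , nu≡K) (v₁ , nv≡K) (w₁ , nw≡K) v≢w uv≡uw =
    ·-untail u v₁≡u₁ (parallel-level-set (proj₂ n) (proj₂ u) n∥u n₃≢0 (·-tail n v₁≡u₁ nv≡nu))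
    where
    v₁≡u₁ : c₁ v ≡ c₁ u
    v₁≡u₁ = trans v₁ (sym u₁)
    nv≡nu : n · v ≡ n · u
    nv≡nu = trans nv≡K (sym nu≡K)
    v₁≡w₁ : c₁ v ≡ c₁ w
    v₁≡w₁ = trans v₁ (sym w₁)
    nv≡nw : n · v ≡ n · w
    nv≡nw = trans nv≡K (sym nw≡K)
    v₂≢w₂ : ¬ c₂ v ≡ c₂ w
    v₂≢w₂ v₂≡w₂ = v≢w (·-cancel₃ n v₁≡w₁ v₂≡w₂ n₃≢0 nv≡nw)
    n∥u : Parallel (proj₂ n) (proj₂ u)
    n∥u = parallel-from-two-points (proj₂ n) (proj₂ u) (proj₂ v) (proj₂ w) v₂≢w₂
            (·-tail n v₁≡w₁ nv≡nw) (·-tail u v₁≡w₁ uv≡uw)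

  DotIsNorm DotNotNorm : Vec3 → Vec3 → Set
  DotIsNorm x y  = x · y ≡ x · x ⊎ x · y ≡ y · y
  DotNotNorm x y = ¬ x · y ≡ x · x × ¬ x · y ≡ y · y

  dotIsNorm-sym : ∀ {x y} → DotIsNorm x y → DotIsNorm y x
  dotIsNorm-sym {x} {y} (inj₁ xy≡xx) = inj₂ (trans (·-comm y x) xy≡xx)
  dotIsNorm-sym {x} {y} (inj₂ xy≡yy) = inj₁ (trans (·-comm y x) xy≡yy)

  dotNotNorm-sym : ∀ {x y} → DotNotNorm x y → DotNotNorm y x
  dotNotNorm-sym {x} {y} (xy≢xx , xy≢yy) =
    (λ yx≡yy → xy≢yy (trans (·-comm x y) yx≡yy)) , (λ yx≡xx → xy≢xx (trans (·-comm x y) yx≡xx))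

  -- A partial specification of edgeType x y for x <ₗ y.
  data Edge (x y : Vec3) : EdgeType → Set where
    up₁   : x · y ≡ x · x → c₁ x < c₁ y → Edge x y UP₁
    up₂   : x · y ≡ x · x → c₁ x ≡ c₁ y → Edge x y UP₂
    down₁ : x · y ≡ y · y → c₁ x < c₁ y → Edge x y DOWN₁
    down₂ : x · y ≡ y · y → c₁ x ≡ c₁ y → Edge x y DOWN₂
    zero  : DotNotNorm x y → x · y ≡ 0# → Edge x y ZERO
    dot   : DotNotNorm x y → Edge x y DOT

  <ₗ-head : ∀ {x y} → x <ₗ y → ¬ c₁ x < c₁ y → c₁ x ≡ c₁ y
  <ₗ-head (inj₁ x₁<y₁) x₁≮y₁ = ⊥-elim (x₁≮y₁ x₁<y₁)
  <ₗ-head (inj₂ (x₁≡y₁ , _)) _ = x₁≡y₁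

  edgeType-edge : ∀ x y → x <ₗ y → Edge x y (edgeType x y)
  edgeType-edge x y x<y with (x · y) ≟ (x · x)
  ... | yes xy≡xx with c₁ x <? c₁ y
  ...   | yes x₁<y₁ = up₁ xy≡xx x₁<y₁
  ...   | no x₁≮y₁ with c₁ x ≟ c₁ y | x <ₗ? y
  ...     | yes x₁≡y₁ | yes _   = up₂ xy≡xx x₁≡y₁
  ...     | no x₁≢y₁  | _       = ⊥-elim (x₁≢y₁ (<ₗ-head x<y x₁≮y₁))
  ...     | yes _     | no x≮y  = ⊥-elim (x≮y x<y)
  edgeType-edge x y x<y | no xy≢xx with (x · y) ≟ (y · y)
  ...   | yes xy≡yy with c₁ x <? c₁ y
  ...     | yes x₁<y₁ = down₁ xy≡yy x₁<y₁
  ...     | no x₁≮y₁ with c₁ x ≟ c₁ y | x <ₗ? y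
  ...       | yes x₁≡y₁ | yes _   = down₂ xy≡yy x₁≡y₁
  ...       | no x₁≢y₁  | _       = ⊥-elim (x₁≢y₁ (<ₗ-head x<y x₁≮y₁))
  ...       | yes _     | no x≮y  = ⊥-elim (x≮y x<y)
  edgeType-edge x y x<y | no xy≢xx | no xy≢yy with (x · y) ≟ 0#
  ...     | yes xy≡0 = zero (xy≢xx , xy≢yy) xy≡0
  ...     | no _     = dot (xy≢xx , xy≢yy)

  -- _<ₗ_ is, definitionally, the library's lexicographic product of _<_ with itself.
  <ₗ-isStrictTotalOrder : IsStrictTotalOrder (Pointwise _≡_ (Pointwise _≡_ _≡_)) _<ₗ_
  <ₗ-isStrictTotalOrder = ×-isStrictTotalOrder lin (×-isStrictTotalOrder lin lin)

  <ₗ-flip : ∀ {x y} → ¬ x ≡ y → ¬ x <ₗ y → y <ₗ x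
  <ₗ-flip {x} {y} x≢y x≮y with IsStrictTotalOrder.compare <ₗ-isStrictTotalOrder x y
  ... | tri< x<y _ _ = ⊥-elim (x≮y x<y)
  ... | tri≈ _ (x₁≡y₁ , x₂₃≡y₂₃) _ = ⊥-elim (x≢y (≡×≡⇒≡ (x₁≡y₁ , ≡×≡⇒≡ x₂₃≡y₂₃)))
  ... | tri> _ _ y<x = y<x

  χ₁-sym : ∀ (x y : V) → ¬ proj₁ x ≡ proj₁ y → χ₁ x y ≡ χ₁ y x
  χ₁-sym (x , _) (y , _) x≢y with x <ₗ? y | y <ₗ? x
  ... | yes _   | no _    = refl
  ... | no _    | yes _   = refl
  ... | yes x<y | yes y<x = ⊥-elim (IsStrictTotalOrder.asym <ₗ-isStrictTotalOrder x<y y<x)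
  ... | no x≮y  | no y≮x  = ⊥-elim (y≮x (<ₗ-flip x≢y x≮y))

  ColouredEdge : Vec3 → Vec3 → EdgeType → Carrier → Set
  ColouredEdge x y T α = Edge x y T × α ≡ fT T x y

  χ₀-edge : ∀ {x y T α i} → x <ₗ y → χ₀ x y ≡ (T , α , i) → ColouredEdge x y T α
  χ₀-edge {x} {y} x<y refl = edgeType-edge x y x<y , refl

  χ₁-edge : ∀ (x y : V) {T α i} → ¬ proj₁ x ≡ proj₁ y → χ₁ x y ≡ (T , α , i) →
    ColouredEdge (proj₁ x) (proj₁ y) T α ⊎ ColouredEdge (proj₁ y) (proj₁ x) T α
  χ₁-edge (x , _) (y , _) x≢y χ≡ with x <ₗ? y
  ... | yes x<y = inj₁ (χ₀-edge x<y χ≡)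
  ... | no x≮y  = inj₂ (χ₀-edge (<ₗ-flip x≢y x≮y) χ≡)

  -- The colour (T , f) of an edge between two points with equal first coordinate, orientation forgotten.
  LevelEdge : EdgeType → Carrier → Vec3 → Vec3 → Set
  LevelEdge UP₂   f x y = DotIsNorm x y × f ≡ c₂ x + c₂ y
  LevelEdge DOWN₂ f x y = DotIsNorm x y × f ≡ c₂ x + c₂ y
  LevelEdge ZERO  f x y = DotNotNorm x y × x · y ≡ 0#
  LevelEdge DOT   f x y = DotNotNorm x y × f ≡ x · y
  LevelEdge UP₁   f x y = ⊥
  LevelEdge DOWN₁ f x y = ⊥

  levelEdge-sym : ∀ T {f x y} → LevelEdge T f x y → LevelEdge T f y x
  levelEdge-sym UP₂   {x = x} {y} (t , f≡) = dotIsNorm-sym t , trans f≡ (+-comm (c₂ x) (c₂ y))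
  levelEdge-sym DOWN₂ {x = x} {y} (t , f≡) = dotIsNorm-sym t , trans f≡ (+-comm (c₂ x) (c₂ y))
  levelEdge-sym ZERO  {x = x} {y} (s , xy≡0) = dotNotNorm-sym s , trans (·-comm y x) xy≡0
  levelEdge-sym DOT   {x = x} {y} (s , f≡) = dotNotNorm-sym s , trans f≡ (·-comm x y)

  edge-level : ∀ {x y T} → c₁ x ≡ c₁ y → Edge x y T → LevelEdge T (fT T x y) x y
  edge-level _      (up₂ xy≡xx _)     = inj₁ xy≡xx , refl
  edge-level _      (down₂ xy≡yy _)   = inj₂ xy≡yy , refl
  edge-level _      (zero s xy≡0)     = s , xy≡0
  edge-level _      (dot s)           = s , refl
  edge-level x₁≡y₁  (up₁ _ x₁<y₁)     = irrefl x₁≡y₁ x₁<y₁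
  edge-level x₁≡y₁  (down₁ _ x₁<y₁)   = irrefl x₁≡y₁ x₁<y₁

  χ₁-level : ∀ (x y : V) {T f i} → c₁ (proj₁ x) ≡ c₁ (proj₁ y) → ¬ proj₁ x ≡ proj₁ y →
    χ₁ x y ≡ (T , f , i) → LevelEdge T f (proj₁ x) (proj₁ y)
  χ₁-level x y {T} x₁≡y₁ x≢y χ≡ with χ₁-edge x y x≢y χ≡
  ... | inj₁ (e , refl) = edge-level x₁≡y₁ e
  ... | inj₂ (e , refl) = levelEdge-sym T (edge-level (sym x₁≡y₁) e)

  levelEdge-same-colour : ∀ T {f u v w} → LevelEdge T f u v → LevelEdge T f u w →
    (c₂ v ≡ c₂ w × DotIsNorm u v) ⊎ (u · v ≡ u · w × ¬ u · v ≡ u · u)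
  levelEdge-same-colour UP₂   {u = u} (t , f≡v) (_ , f≡w) =
    inj₁ (∙-cancelˡ (c₂ u) _ _ (trans (sym f≡v) f≡w) , t)
  levelEdge-same-colour DOWN₂ {u = u} (t , f≡v) (_ , f≡w) =
    inj₁ (∙-cancelˡ (c₂ u) _ _ (trans (sym f≡v) f≡w) , t)
  levelEdge-same-colour ZERO  (s , uv≡0) (_ , uw≡0) = inj₂ (trans uv≡0 (sym uw≡0) , proj₁ s)
  levelEdge-same-colour DOT   (s , f≡uv) (_ , f≡uw) = inj₂ (trans (sym f≡uv) f≡uw , proj₁ s)

  vertical-no-repeat : ∀ {p q} T {f u v w} → ¬ c₃ u ≡ 0# → ¬ c₃ v ≡ 0# →
    let ℓ = vertical p q in u ∈ℓ ℓ → v ∈ℓ ℓ → w ∈ℓ ℓ →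
    ¬ u ≡ v → ¬ v ≡ w → LevelEdge T f u v → LevelEdge T f u w → ⊥
  vertical-no-repeat T {u = _ , _ , _} {_ , _ , _} {_ , _ , _} u₃≢0 v₃≢0
                     (refl , refl) (refl , refl) (refl , refl) u≢v v≢w uv uw
    with levelEdge-same-colour T uv uw
  ... | inj₁ (_ , inj₁ uv≡uu) = u≢v (sym (·-cancel₃ _ refl refl u₃≢0 uv≡uu))
  ... | inj₁ (_ , inj₂ uv≡vv) = u≢v (·-cancel₃ _ refl refl v₃≢0 (trans (·-comm _ _) uv≡vv))
  ... | inj₂ (uv≡uw , _)      = v≢w (·-cancel₃ _ refl refl u₃≢0 uv≡uw)

  oblique-no-repeat : ∀ {p n K} (n₃≢0 : ¬ c₃ n ≡ 0#) T {f u v w} →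
    let ℓ = oblique p n K n₃≢0 in u ∈ℓ ℓ → v ∈ℓ ℓ → w ∈ℓ ℓ →
    ¬ v ≡ w → LevelEdge T f u v → LevelEdge T f u w → ⊥
  oblique-no-repeat {n = n} n₃≢0 T u∈ℓ v∈ℓ@(v₁ , nv≡K) w∈ℓ@(w₁ , nw≡K) v≢w uv uw
    with levelEdge-same-colour T uv uw
  ... | inj₁ (v₂≡w₂ , _) = v≢w (·-cancel₃ n (trans v₁ (sym w₁)) v₂≡w₂ n₃≢0 (trans nv≡K (sym nw≡K)))
  ... | inj₂ (uv≡uw , uv≢uu) = uv≢uu (oblique-dot-constant n₃≢0 u∈ℓ v∈ℓ w∈ℓ v≢w uv≡uw)

  c₃≢0 : (x : V) → ¬ c₃ (proj₁ x) ≡ 0#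
  c₃≢0 (_ , _ , _ , x₃≢0) = x₃≢0

  plane : Line → Carrier
  plane (vertical p _)      = p
  plane (oblique p _ _ _)   = p

  ∈ℓ⇒c₁≡plane : ∀ ℓ {x} → x ∈ℓ ℓ → c₁ x ≡ plane ℓ
  ∈ℓ⇒c₁≡plane (vertical _ _)    = proj₁
  ∈ℓ⇒c₁≡plane (oblique _ _ _ _) = proj₁

  line-no-repeat : ∀ ℓ T {f} (u v w : V) →
    proj₁ u ∈ℓ ℓ → proj₁ v ∈ℓ ℓ → proj₁ w ∈ℓ ℓ → ¬ proj₁ u ≡ proj₁ v → ¬ proj₁ v ≡ proj₁ w →
    LevelEdge T f (proj₁ u) (proj₁ v) → LevelEdge T f (proj₁ u) (proj₁ w) → ⊥
  line-no-repeat (vertical _ _) T u v w u∈ℓ v∈ℓ w∈ℓ u≢v v≢w =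
    vertical-no-repeat T (c₃≢0 u) (c₃≢0 v) u∈ℓ v∈ℓ w∈ℓ u≢v v≢w
  line-no-repeat (oblique _ _ _ n₃≢0) T u v w u∈ℓ v∈ℓ w∈ℓ _ v≢w =
    oblique-no-repeat n₃≢0 T u∈ℓ v∈ℓ w∈ℓ v≢w

  no-repeated-colour : ∀ ℓ (u v w : V) → proj₁ u ∈ℓ ℓ → proj₁ v ∈ℓ ℓ → proj₁ w ∈ℓ ℓ →
    ¬ proj₁ u ≡ proj₁ v → ¬ proj₁ u ≡ proj₁ w → ¬ proj₁ v ≡ proj₁ w → ¬ χ₁ u v ≡ χ₁ u w
  no-repeated-colour ℓ u v w u∈ℓ v∈ℓ w∈ℓ u≢v u≢w v≢w χuv≡χuw =
    line-no-repeat ℓ (proj₁ (χ₁ u w)) u v w u∈ℓ v∈ℓ w∈ℓ u≢v v≢w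
      (χ₁-level u v (same-plane v∈ℓ) u≢v χuv≡χuw) (χ₁-level u w (same-plane w∈ℓ) u≢w refl)
    where
    same-plane : ∀ {x} → x ∈ℓ ℓ → c₁ (proj₁ u) ≡ c₁ x
    same-plane x∈ℓ = trans (∈ℓ⇒c₁≡plane ℓ u∈ℓ) (sym (∈ℓ⇒c₁≡plane ℓ x∈ℓ))

  rainbow : ∀ ℓ (b c d : V) → ¬ proj₁ b ≡ proj₁ c → ¬ proj₁ b ≡ proj₁ d → ¬ proj₁ c ≡ proj₁ d →
    proj₁ b ∈ℓ ℓ → proj₁ c ∈ℓ ℓ → proj₁ d ∈ℓ ℓ →
    ¬ (χ₁ b c ≡ χ₁ b d) × ¬ (χ₁ b c ≡ χ₁ c d) × ¬ (χ₁ b d ≡ χ₁ c d)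
  rainbow ℓ b c d b≢c b≢d c≢d b∈ℓ c∈ℓ d∈ℓ =
      no-repeated-colour ℓ b c d b∈ℓ c∈ℓ d∈ℓ b≢c b≢d c≢d
    , (λ χbc≡χcd → no-repeated-colour ℓ c b d c∈ℓ b∈ℓ d∈ℓ (≢-sym b≢c) c≢d b≢d
                     (trans (χ₁-sym c b (≢-sym b≢c)) χbc≡χcd))
    , (λ χbd≡χcd → no-repeated-colour ℓ d b c d∈ℓ b∈ℓ c∈ℓ (≢-sym b≢d) (≢-sym c≢d) b≢c
                     (trans (χ₁-sym d b (≢-sym b≢d)) (trans χbd≡χcd (χ₁-sym c d c≢d))))

  fibre : V → Carrier → Carrier → Line
  fibre a α K = oblique (α - c₁ (proj₁ a)) (proj₁ a) K (c₃≢0 a)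

  level-coloured-edge : ∀ {x y T α} → T ≡ UP₂ ⊎ T ≡ DOWN₂ → ColouredEdge x y T α →
    c₁ x ≡ c₁ y × α ≡ c₂ x + c₂ y
  level-coloured-edge (inj₁ refl) (up₂ _ x₁≡y₁ , α≡)   = x₁≡y₁ , α≡
  level-coloured-edge (inj₂ refl) (down₂ _ x₁≡y₁ , α≡) = x₁≡y₁ , α≡

  neighbour-vertical : ∀ {T α i} (a b : V) → ¬ proj₁ a ≡ proj₁ b → T ≡ UP₂ ⊎ T ≡ DOWN₂ →
    χ₁ a b ≡ (T , α , i) → proj₁ b ∈ℓ vertical (c₁ (proj₁ a)) (α - c₂ (proj₁ a))
  neighbour-vertical a b a≢b level χ≡ with χ₁-edge a b a≢b χ≡
  ... | inj₁ ab with level-coloured-edge level ab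
  ...   | a₁≡b₁ , α≡a₂+b₂ = sym a₁≡b₁ , x≡y+z⇒z≡x-y α≡a₂+b₂
  neighbour-vertical a b a≢b level χ≡ | inj₂ ba with level-coloured-edge level ba
  ...   | b₁≡a₁ , α≡b₂+a₂ = b₁≡a₁ , x≡y+z⇒y≡x-z α≡b₂+a₂

  neighbour-zero : ∀ {α i} (a b : V) → ¬ proj₁ a ≡ proj₁ b → χ₁ a b ≡ (ZERO , α , i) →
    proj₁ b ∈ℓ fibre a α 0#
  neighbour-zero a b a≢b χ≡ with χ₁-edge a b a≢b χ≡
  ... | inj₁ (zero _ ab≡0 , α≡a₁+b₁) = x≡y+z⇒z≡x-y α≡a₁+b₁ , ab≡0
  ... | inj₂ (zero _ ba≡0 , α≡b₁+a₁) = x≡y+z⇒y≡x-z α≡b₁+a₁ , trans (·-comm (proj₁ a) (proj₁ b)) ba≡0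

  -- The hypothesis a₁ < α − a₁ = b₁ rules out the orientation b <ₗ a, where b₁ < a₁.
  neighbour-up : ∀ {α i} (a b : V) → ¬ proj₁ a ≡ proj₁ b → c₁ (proj₁ a) < (α - c₁ (proj₁ a)) →
    χ₁ a b ≡ (UP₁ , α , i) → proj₁ b ∈ℓ fibre a α (proj₁ a · proj₁ a)
  neighbour-up a b a≢b a₁<b₁ χ≡ with χ₁-edge a b a≢b χ≡
  ... | inj₁ (up₁ ab≡aa _ , α≡a₁+b₁) = x≡y+z⇒z≡x-y α≡a₁+b₁ , ab≡aa
  ... | inj₂ (up₁ _ b₁<a₁ , α≡b₁+a₁) =
    ⊥-elim (asym b₁<a₁ (subst (c₁ (proj₁ a) <_) (sym (x≡y+z⇒y≡x-z α≡b₁+a₁)) a₁<b₁))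

  neighbour-down : ∀ {α i} (a b : V) → ¬ proj₁ a ≡ proj₁ b → (α - c₁ (proj₁ a)) < c₁ (proj₁ a) →
    χ₁ a b ≡ (DOWN₁ , α , i) → proj₁ b ∈ℓ fibre a α (proj₁ a · proj₁ a)
  neighbour-down a b a≢b b₁<a₁ χ≡ with χ₁-edge a b a≢b χ≡
  ... | inj₁ (down₁ _ a₁<b₁ , α≡a₁+b₁) =
    ⊥-elim (asym a₁<b₁ (subst (_< c₁ (proj₁ a)) (sym (x≡y+z⇒z≡x-y α≡a₁+b₁)) b₁<a₁))
  ... | inj₂ (down₁ ba≡aa _ , α≡b₁+a₁) = x≡y+z⇒y≡x-z α≡b₁+a₁ , trans (·-comm (proj₁ a) (proj₁ b)) ba≡aa

  neighbours-collinear : ∀ (a : V) {T α i} →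
    ((T ≡ ZERO ⊎ T ≡ UP₂ ⊎ T ≡ DOWN₂)
     ⊎ (T ≡ UP₁ × c₁ (proj₁ a) < (α - c₁ (proj₁ a)))
     ⊎ (T ≡ DOWN₁ × (α - c₁ (proj₁ a)) < c₁ (proj₁ a))) →
    Σ Line λ ℓ → ∀ b → ¬ proj₁ a ≡ proj₁ b → χ₁ a b ≡ (T , α , i) → proj₁ b ∈ℓ ℓ
  neighbours-collinear a {α = α} (inj₁ (inj₁ refl)) =
    fibre a α 0# , λ b a≢b → neighbour-zero a b a≢b
  neighbours-collinear a {α = α} (inj₁ (inj₂ level)) =
    vertical (c₁ (proj₁ a)) (α - c₂ (proj₁ a)) , λ b a≢b → neighbour-vertical a b a≢b level
  neighbours-collinear a {α = α} (inj₂ (inj₁ (refl , a₁<b₁))) =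
    fibre a α (proj₁ a · proj₁ a) , λ b a≢b → neighbour-up a b a≢b a₁<b₁
  neighbours-collinear a {α = α} (inj₂ (inj₂ (refl , b₁<a₁))) =
    fibre a α (proj₁ a · proj₁ a) , λ b a≢b → neighbour-down a b a≢b b₁<a₁

mainTheorem11 : (F : FiniteOddField) (_<_ : Rel (FiniteOddField.Carrier F) 0ℓ)
    (lin : IsStrictTotalOrder _≡_ _<_) →
    let open FiniteOddField F
        open Coloring F _<_ lin
    in (a b c d : V) →
       ¬ (proj₁ a ≡ proj₁ b) → ¬ (proj₁ a ≡ proj₁ c) → ¬ (proj₁ a ≡ proj₁ d) →
       ¬ (proj₁ b ≡ proj₁ c) → ¬ (proj₁ b ≡ proj₁ d) → ¬ (proj₁ c ≡ proj₁ d) →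
       (T : EdgeType) (α : Carrier) (i : Bool) →
       χ₁ a b ≡ (T , α , i) → χ₁ a c ≡ (T , α , i) → χ₁ a d ≡ (T , α , i) →
       ((T ≡ ZERO ⊎ T ≡ UP₂ ⊎ T ≡ DOWN₂)
        ⊎ (T ≡ UP₁ × c₁ (proj₁ a) < (α - c₁ (proj₁ a)))
        ⊎ (T ≡ DOWN₁ × (α - c₁ (proj₁ a)) < c₁ (proj₁ a))) →
       ¬ (χ₁ b c ≡ χ₁ b d) × ¬ (χ₁ b c ≡ χ₁ c d) × ¬ (χ₁ b d ≡ χ₁ c d)
mainTheorem11 F _<_ lin a b c d a≢b a≢c a≢d b≢c b≢d c≢d _ _ _ χab χac χad hyp =
  let open Rainbow F _<_ lin
      (ℓ , on-ℓ) = neighbours-collinear a hyp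
  in rainbow ℓ b c d b≢c b≢d c≢d (on-ℓ b a≢b χab) (on-ℓ c a≢c χac) (on-ℓ d a≢d χad)
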